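{- The $2$-dimensional butterfly network $BF(2)$ has no edge-forcing set.
   Context: The $r$-dimensional butterfly network $BF(r)$ has vertex set $\{[w;i] : w=(x_1,\dots,x_r)\in\{0,1\}^r,\ 0\le i\le r\}$ (vertex $[w;i]$ is at Level $i$), and $[w;i]$ is adjacent to $[w';j]$ iff $j=i+1$ and either $w=w'$ or $w$ and $w'$ differ precisely in the $j$-th bit. Forcing (closure) rule: for a graph $G=(V,E)$ and $T\subseteq V$, the closure $C_G(T)$ is obtained by starting with $C_G(T)=T$ and, as long as some vertex of $C_G(T)$ has exactly one neighbor not in $C_G(T)$, adding that neighbor. Edge-forcing set: a set $K$ of pairwise independent edges (a matching) of $G$ such that, with $T$ the set of endpoints of edges of $K$, $C_G(T)=V$. -}

module Defs where

open import Data.Nat using (ℕ; suc)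
open import Data.Bool using (Bool; not)
open import Data.Fin using (Fin; inject₁) renaming (suc to fsuc)
open import Data.Vec using (Vec; updateAt)
open import Data.Product using (_×_; _,_; proj₁; proj₂; ∃-syntax)
open import Data.Sum using (_⊎_)
open import Data.List using (List; []; _∷_; _++_; concatMap)
open import Data.List.Relation.Unary.All using (All)
open import Data.List.Relation.Unary.Any using (Any)
open import Data.List.Relation.Unary.Unique.Propositional using (Unique)
open import Data.List.Membership.Propositional using (_∈_)
open import Relation.Binary.PropositionalEquality using (_≡_; _≢_)

record Graph : Set₁ where
  field
    V   : Set
    Adj : V → V → Set
open Graph public

-- vertex [w;i] with w ∈ {0,1}^r and level i ∈ {0,…,r}
BFVertex : ℕ → Set
BFVertex r = Vec Bool r × Fin (suc r)

-- Upward step from level i = k to level j = k+1 (k : Fin r, 0-based bit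
-- index k is the j-th bit in 1-based numbering): either same word, or the
-- words differ precisely in the j-th bit.
data BFStep {r : ℕ} : BFVertex r → BFVertex r → Set where
  straight : (w : Vec Bool r) (k : Fin r) →
             BFStep (w , inject₁ k) (w , fsuc k)
  cross    : (w : Vec Bool r) (k : Fin r) →
             BFStep (w , inject₁ k) (updateAt w k not , fsuc k)

BF : ℕ → Graph
BF r = record { V = BFVertex r ; Adj = λ u v → BFStep u v ⊎ BFStep v u }

-- Forcing closure C_G(T): the least set containing T and closed under
-- "if u is in the set and v is the unique neighbour of u outside it,
-- add v".  (Characterised inductively: v can be forced by u once u and all
-- neighbours of u other than v are in the closure.)

data Closure (G : Graph) (T : V G → Set) : V G → Set where
  base  : ∀ {v} → T v → Closure G T v
  force : ∀ {u v} → Closure G T u → Adj G u v →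
          (∀ w → Adj G u w → w ≢ v → Closure G T w) →
          Closure G T v

endpoints : {A : Set} → List (A × A) → List A
endpoints = concatMap (λ e → proj₁ e ∷ proj₂ e ∷ [])

-- K is a matching: every listed pair is an edge and all endpoints are
-- pairwise distinct (so edges are pairwise independent, and no edge is
-- repeated).
IsMatching : (G : Graph) → List (V G × V G) → Set
IsMatching G K = All (λ e → Adj G (proj₁ e) (proj₂ e)) K × Unique (endpoints K)

IsEdgeForcingSet : (G : Graph) → List (V G × V G) → Set
IsEdgeForcingSet G K =
  IsMatching G K × (∀ (v : V G) → Closure G (λ x → x ∈ endpoints K) v)

HasEdgeForcingSet : Graph → Set
HasEdgeForcingSet G = ∃[ K ] IsEdgeForcingSet G K

{-# OPTIONS --safe #-}
module Submission where

open import Defs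
open import Relation.Nullary using (¬_; Dec; yes; no; contradiction; ¬?; _⊎-dec_; decidable-stable)
open import Relation.Unary using (Decidable; ∁)
open import Relation.Unary.Properties using (∁?)
open import Relation.Binary.PropositionalEquality
  using (_≡_; _≢_; refl; sym; trans; cong; subst; ≢-sym; module ≡-Reasoning)
open import Function using (_∘_; case_of_; Injective)
open import Data.Bool using (true; false; not)
open import Data.Bool.Properties using (not-involutive)
import Data.Bool.Properties as Bool
open import Data.Nat using (suc; _≤_)
open import Data.Nat.Properties using (n≮n; module ≤-Reasoning)
open import Data.Fin using (Fin; zero; suc)
import Data.Fin.Properties as Fin
open import Data.Vec using ([]; _∷_)
import Data.Vec.Properties as Vec
open import Data.Product using (_×_; _,_; proj₁; proj₂; ∃-syntax)
import Data.Product.Properties as Product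
open import Data.Sum using (_⊎_; inj₁; inj₂; [_,_])
import Data.Sum as Sum
open import Data.List using (List; []; _∷_; length; map; filter; lookup)
open import Data.List.Properties using (filter-accept; filter-reject; map-∘; map-cong)
open import Data.List.Relation.Unary.All as All using (All; []; _∷_; all?)
open import Data.List.Relation.Unary.All.Properties using (¬All⇒Any¬)
open import Data.List.Relation.Unary.Any as Any using (Any; here; there; index)
open import Data.List.Relation.Unary.Any.Properties using (lookup-index)
open import Data.List.Relation.Unary.AllPairs using ([]; _∷_)
open import Data.List.Relation.Unary.Unique.Propositional using (Unique)
open import Data.List.Relation.Unary.Unique.Propositional.Properties using (filter⁺; map⁻)
open import Data.List.Relation.Binary.Subset.Propositional using (_⊆_)
open import Data.List.Membership.Propositional using (_∈_; _∉_; find)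
open import Data.List.Membership.Propositional.Properties
  using (∈-lookup; ∈-filter⁺; ∈-filter⁻; ∈-map⁻)

-- A fort is a nonempty vertex set F in which no outside vertex has exactly one
-- neighbour, so the forcing closure of a set disjoint from F never enters F.
-- Every edge of BF(2) joins the middle level to an outer level, so a matching has
-- as many outer endpoints as middle ones, hence at most four. The eight outer vertices
-- split into four twin pairs {v , twin v} with equal neighbourhoods. If some pair
-- misses the endpoint set T, it is a fort avoiding T. Otherwise the count forces T to
-- contain at most one vertex of each pair, and the outer vertices outside T form a
-- fort: a middle vertex sees a whole twin pair on each outer side.

module _ {G : Graph} where

  IsFort : (V G → Set) → Set
  IsFort F = ∀ {u v} → ¬ F u → Adj G u v → F v → ∃[ w ] Adj G u w × w ≢ v × F w

  closure-avoids-fort : ∀ {T F} → IsFort F → (∀ {v} → T v → ¬ F v) →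
                        ∀ {v} → Closure G T v → ¬ F v
  closure-avoids-fort fort T∩F≡∅ (base Tv) = T∩F≡∅ Tv
  closure-avoids-fort fort T∩F≡∅ (force Cu u~v rest) Fv
    with fort (closure-avoids-fort fort T∩F≡∅ Cu) u~v Fv
  ... | w , u~w , w≢v , Fw = closure-avoids-fort fort T∩F≡∅ (rest w u~w w≢v) Fw

  twins-fort : ∀ {a b} → a ≢ b → (∀ {u} → Adj G u a → Adj G u b) →
               (∀ {u} → Adj G u b → Adj G u a) → IsFort (λ x → x ≡ a ⊎ x ≡ b)
  twins-fort a≢b a⇒b b⇒a _ u~a (inj₁ refl) = _ , a⇒b u~a , ≢-sym a≢b , inj₂ refl
  twins-fort a≢b a⇒b b⇒a _ u~b (inj₂ refl) = _ , b⇒a u~b , a≢b , inj₁ refl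

record AvoidingFort (G : Graph) (T : V G → Set) : Set₁ where
  field
    F        : V G → Set
    isFort   : IsFort {G} F
    nonempty : ∃[ v ] F v
    disjoint : ∀ {v} → T v → ¬ F v

avoidingFort⇒¬forcing : ∀ {G T} → AvoidingFort G T → ¬ (∀ v → Closure G T v)
avoidingFort⇒¬forcing A forces =
  closure-avoids-fort isFort disjoint (forces (proj₁ nonempty)) (proj₂ nonempty)
  where open AvoidingFort A

unique-lookup-injective : ∀ {A : Set} {xs : List A} → Unique xs →
                          Injective _≡_ _≡_ (lookup xs)
unique-lookup-injective (_ ∷ _)    {zero}  {zero}  _  = refl
unique-lookup-injective (x∉xs ∷ _) {zero}  {suc j} eq =
  contradiction eq (All.lookup x∉xs (∈-lookup j))
unique-lookup-injective (x∉xs ∷ _) {suc i} {zero}  eq =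
  contradiction (sym eq) (All.lookup x∉xs (∈-lookup i))
unique-lookup-injective (_ ∷ u)    {suc i} {suc j} eq = cong suc (unique-lookup-injective u eq)

unique-⊆⇒length≤ : ∀ {A : Set} {xs ys : List A} → Unique xs → xs ⊆ ys → length xs ≤ length ys
unique-⊆⇒length≤ {xs = xs} {ys} u xs⊆ys = Fin.injective⇒≤ position-injective
  where
  position : Fin (length xs) → Fin (length ys)
  position i = index (xs⊆ys (∈-lookup i))

  position-injective : Injective _≡_ _≡_ position
  position-injective {i} {j} eq = unique-lookup-injective u (begin
    lookup xs i                ≡⟨ lookup-index (xs⊆ys (∈-lookup i)) ⟩
    lookup ys (position i)     ≡⟨ cong (lookup ys) eq ⟩
    lookup ys (position j)     ≡⟨ lookup-index (xs⊆ys (∈-lookup j)) ⟨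
    lookup xs j                ∎)
    where open ≡-Reasoning

Straddles : ∀ {A : Set} → (A → Set) → A × A → Set
Straddles P (a , b) = (P a × ¬ P b) ⊎ (¬ P a × P b)

straddles-∁ : ∀ {A : Set} {P : A → Set} {e} → Straddles P e → Straddles (∁ P) e
straddles-∁ (inj₁ (Pa , ¬Pb)) = inj₂ ((λ ¬Pa → ¬Pa Pa) , ¬Pb)
straddles-∁ (inj₂ (¬Pa , Pb)) = inj₁ (¬Pa , (λ ¬Pb → ¬Pb Pb))

module _ {A : Set} {P : A → Set} (P? : Decidable P) where

  length-filter-endpoints : ∀ {K} → All (Straddles P) K →
                            length (filter P? (endpoints K)) ≡ length K
  length-filter-endpoints [] = refl
  length-filter-endpoints {(a , b) ∷ K} (inj₁ (Pa , ¬Pb) ∷ s) = begin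
    length (filter P? (a ∷ b ∷ endpoints K))   ≡⟨ cong length (filter-accept P? Pa) ⟩
    suc (length (filter P? (b ∷ endpoints K))) ≡⟨ cong (suc ∘ length) (filter-reject P? ¬Pb) ⟩
    suc (length (filter P? (endpoints K)))     ≡⟨ cong suc (length-filter-endpoints s) ⟩
    suc (length K)                             ∎
    where open ≡-Reasoning
  length-filter-endpoints {(a , b) ∷ K} (inj₂ (¬Pa , Pb) ∷ s) = begin
    length (filter P? (a ∷ b ∷ endpoints K)) ≡⟨ cong length (filter-reject P? ¬Pa) ⟩
    length (filter P? (b ∷ endpoints K))     ≡⟨ cong length (filter-accept P? Pb) ⟩
    suc (length (filter P? (endpoints K)))   ≡⟨ cong suc (length-filter-endpoints s) ⟩
    suc (length K)                           ∎
    where open ≡-Reasoning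

straddling-endpoints-balanced :
  ∀ {A : Set} {P : A → Set} (P? : Decidable P) {K} → All (Straddles P) K →
  length (filter P? (endpoints K)) ≡ length (filter (∁? P?) (endpoints K))
straddling-endpoints-balanced {P = P} P? s =
  trans (length-filter-endpoints P? s)
        (sym (length-filter-endpoints (∁? P?) (All.map (straddles-∁ {P = P}) s)))

Vertex : Set
Vertex = BFVertex 2

_≟_ : (u v : Vertex) → Dec (u ≡ v)
_≟_ = Product.≡-dec (Vec.≡-dec Bool._≟_) Fin._≟_

open import Data.List.Membership.DecPropositional _≟_ using (_∈?_)

_~_ : Vertex → Vertex → Set
_~_ = Adj (BF 2)

level : Vertex → Fin 3
level = proj₂

Middle : Vertex → Set
Middle v = level v ≡ suc zero

middle? : Decidable Middle
middle? v = level v Fin.≟ suc zero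

Outer : Vertex → Set
Outer = ∁ Middle

adj-straddles : ∀ {u v} → u ~ v → Straddles Middle (u , v)
adj-straddles (inj₁ (straight w zero))       = inj₂ ((λ ()) , refl)
adj-straddles (inj₁ (cross    w zero))       = inj₂ ((λ ()) , refl)
adj-straddles (inj₁ (straight w (suc zero))) = inj₁ (refl , (λ ()))
adj-straddles (inj₁ (cross    w (suc zero))) = inj₁ (refl , (λ ()))
adj-straddles (inj₂ (straight w zero))       = inj₁ (refl , (λ ()))
adj-straddles (inj₂ (cross    w zero))       = inj₁ (refl , (λ ()))
adj-straddles (inj₂ (straight w (suc zero))) = inj₂ ((λ ()) , refl)
adj-straddles (inj₂ (cross    w (suc zero))) = inj₂ ((λ ()) , refl)

-- Flips the bit that the neighbours of an outer vertex do not see.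
twin : Vertex → Vertex
twin (x ∷ y ∷ [] , zero)           = not x ∷ y ∷ [] , zero
twin (x ∷ y ∷ [] , suc zero)       = x ∷ y ∷ [] , suc zero
twin (x ∷ y ∷ [] , suc (suc zero)) = x ∷ not y ∷ [] , suc (suc zero)

level-twin : ∀ v → level (twin v) ≡ level v
level-twin (x ∷ y ∷ [] , zero)           = refl
level-twin (x ∷ y ∷ [] , suc zero)       = refl
level-twin (x ∷ y ∷ [] , suc (suc zero)) = refl

outer-twin : ∀ {v} → Outer v → Outer (twin v)
outer-twin {v} outer middle = outer (trans (sym (level-twin v)) middle)

twin-involutive : ∀ v → twin (twin v) ≡ v
twin-involutive (x ∷ y ∷ [] , zero)           = cong (λ b → b ∷ y ∷ [] , zero) (not-involutive x)
twin-involutive (x ∷ y ∷ [] , suc zero)       = refl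
twin-involutive (x ∷ y ∷ [] , suc (suc zero)) =
  cong (λ b → x ∷ b ∷ [] , suc (suc zero)) (not-involutive y)

twin-≢ : ∀ {v} → Outer v → twin v ≢ v
twin-≢ {false ∷ y ∷ [] , zero}           _ ()
twin-≢ {true  ∷ y ∷ [] , zero}           _ ()
twin-≢ {x ∷ y ∷ [] , suc zero}           outer _ = outer refl
twin-≢ {x ∷ false ∷ [] , suc (suc zero)} _ ()
twin-≢ {x ∷ true  ∷ [] , suc (suc zero)} _ ()

adj-twin : ∀ {u v} → Outer v → u ~ v → u ~ twin v
adj-twin outer (inj₁ (straight w zero))                      = contradiction refl outer
adj-twin outer (inj₁ (cross    w zero))                      = contradiction refl outer
adj-twin _     (inj₁ (straight (x ∷ y ∷ []) (suc zero)))     = inj₁ (cross (x ∷ y ∷ []) (suc zero))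
adj-twin _     (inj₁ (cross    (x ∷ false ∷ []) (suc zero))) = inj₁ (straight (x ∷ false ∷ []) (suc zero))
adj-twin _     (inj₁ (cross    (x ∷ true  ∷ []) (suc zero))) = inj₁ (straight (x ∷ true ∷ []) (suc zero))
adj-twin _     (inj₂ (straight (false ∷ y ∷ []) zero))       = inj₂ (cross (true ∷ y ∷ []) zero)
adj-twin _     (inj₂ (straight (true  ∷ y ∷ []) zero))       = inj₂ (cross (false ∷ y ∷ []) zero)
adj-twin _     (inj₂ (cross    (x ∷ y ∷ []) zero))           = inj₂ (straight (not x ∷ y ∷ []) zero)
adj-twin outer (inj₂ (straight w (suc zero)))                = contradiction refl outer
adj-twin outer (inj₂ (cross    w (suc zero)))                = contradiction refl outer

twin-fort : ∀ {v} → Outer v → IsFort {BF 2} (λ x → x ≡ v ⊎ x ≡ twin v)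
twin-fort {v} outer = twins-fort {a = v} (≢-sym (twin-≢ outer)) (adj-twin outer)
  (λ {u} u~tv → subst (u ~_) (twin-involutive v) (adj-twin (outer-twin {v} outer) u~tv))

opposite-neighbour : ∀ {u v} → u ~ v → Outer v → ∃[ o ] u ~ o × Outer o × level o ≢ level v
opposite-neighbour (inj₁ (straight w zero))       outer = contradiction refl outer
opposite-neighbour (inj₁ (cross    w zero))       outer = contradiction refl outer
opposite-neighbour (inj₁ (straight w (suc zero))) _     =
  (w , zero) , inj₂ (straight w zero) , (λ ()) , (λ ())
opposite-neighbour (inj₁ (cross    w (suc zero))) _     =
  (w , zero) , inj₂ (straight w zero) , (λ ()) , (λ ())
opposite-neighbour (inj₂ (straight w zero))       _     =
  (w , suc (suc zero)) , inj₁ (straight w (suc zero)) , (λ ()) , (λ ())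
opposite-neighbour (inj₂ (cross    w zero))       _     =
  (_ , suc (suc zero)) , inj₁ (straight _ (suc zero)) , (λ ()) , (λ ())
opposite-neighbour (inj₂ (straight w (suc zero))) outer = contradiction refl outer
opposite-neighbour (inj₂ (cross    w (suc zero))) outer = contradiction refl outer

outer-unused-fort : ∀ {T : Vertex → Set} → (∀ {v} → Outer v → ¬ T v ⊎ ¬ T (twin v)) →
                    IsFort {BF 2} (λ v → Outer v × ¬ T v)
outer-unused-fort unused _ u~v (outer-v , _) with opposite-neighbour u~v outer-v
... | o , u~o , outer-o , o≁v with unused outer-o
...   | inj₁ o∉T  = o , u~o , (o≁v ∘ cong level) , outer-o , o∉T
...   | inj₂ o'∉T = twin o , adj-twin outer-o u~o
                  , (λ o'≡v → o≁v (trans (sym (level-twin o)) (cong level o'≡v)))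
                  , outer-twin {o} outer-o , o'∉T

representatives : List Vertex
representatives = (false ∷ false ∷ [] , zero) ∷ (false ∷ true ∷ [] , zero)
                ∷ (false ∷ false ∷ [] , suc (suc zero)) ∷ (true ∷ false ∷ [] , suc (suc zero)) ∷ []

rep : Vertex → Vertex
rep (x ∷ y ∷ [] , zero)           = false ∷ y ∷ [] , zero
rep (x ∷ y ∷ [] , suc zero)       = x ∷ y ∷ [] , suc zero
rep (x ∷ y ∷ [] , suc (suc zero)) = x ∷ false ∷ [] , suc (suc zero)

rep-twin : ∀ v → rep (twin v) ≡ rep v
rep-twin (x ∷ y ∷ [] , zero)           = refl
rep-twin (x ∷ y ∷ [] , suc zero)       = refl
rep-twin (x ∷ y ∷ [] , suc (suc zero)) = refl

rep-cases : ∀ {v} → Outer v → rep v ≡ v ⊎ rep v ≡ twin v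
rep-cases {false ∷ y ∷ [] , zero}           _     = inj₁ refl
rep-cases {true  ∷ y ∷ [] , zero}           _     = inj₂ refl
rep-cases {x ∷ y ∷ [] , suc zero}           outer = contradiction refl outer
rep-cases {x ∷ false ∷ [] , suc (suc zero)} _     = inj₁ refl
rep-cases {x ∷ true  ∷ [] , suc (suc zero)} _     = inj₂ refl

rep∈representatives : ∀ {v} → Outer v → rep v ∈ representatives
rep∈representatives {x ∷ false ∷ [] , zero}           _     = here refl
rep∈representatives {x ∷ true  ∷ [] , zero}           _     = there (here refl)
rep∈representatives {x ∷ y ∷ [] , suc zero}           outer = contradiction refl outer
rep∈representatives {false ∷ y ∷ [] , suc (suc zero)} _     = there (there (here refl))
rep∈representatives {true  ∷ y ∷ [] , suc (suc zero)} _     = there (there (there (here refl)))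

representatives-outer : All Outer representatives
representatives-outer = (λ ()) ∷ (λ ()) ∷ (λ ()) ∷ (λ ()) ∷ []

rep-fixes-representatives : All (λ r → rep r ≡ r) representatives
rep-fixes-representatives = refl ∷ refl ∷ refl ∷ refl ∷ []

unique-representatives : Unique representatives
unique-representatives =
  ((λ ()) ∷ (λ ()) ∷ (λ ()) ∷ []) ∷ ((λ ()) ∷ (λ ()) ∷ []) ∷ ((λ ()) ∷ []) ∷ [] ∷ []

pair-from-rep : ∀ (Q : Vertex → Set) {v} → Outer v →
                Q (rep v) ⊎ Q (twin (rep v)) → Q v ⊎ Q (twin v)
pair-from-rep Q {v} outer q with rep-cases outer
... | inj₁ r≡v  = Sum.map (subst Q r≡v) (subst Q (cong twin r≡v)) q
... | inj₂ r≡v' = Sum.swap (Sum.map (subst Q r≡v') (subst Q r'≡v) q)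
  where
  r'≡v : twin (rep v) ≡ v
  r'≡v = trans (cong twin r≡v') (twin-involutive v)

middle-vertices : List Vertex
middle-vertices = (false ∷ false ∷ [] , suc zero) ∷ (false ∷ true ∷ [] , suc zero)
                ∷ (true ∷ false ∷ [] , suc zero) ∷ (true ∷ true ∷ [] , suc zero) ∷ []

middle∈middle-vertices : ∀ {v} → Middle v → v ∈ middle-vertices
middle∈middle-vertices {false ∷ false ∷ [] , suc zero} refl = here refl
middle∈middle-vertices {false ∷ true  ∷ [] , suc zero} refl = there (here refl)
middle∈middle-vertices {true  ∷ false ∷ [] , suc zero} refl = there (there (here refl))
middle∈middle-vertices {true  ∷ true  ∷ [] , suc zero} refl = there (there (there (here refl)))

module _ {T : List Vertex} where

  length-middle≤4 : Unique T → length (filter middle? T) ≤ 4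
  length-middle≤4 unique-T = unique-⊆⇒length≤ (filter⁺ middle? unique-T)
    (λ v∈ → middle∈middle-vertices (proj₂ (∈-filter⁻ middle? {xs = T} v∈)))

  private
    choose : Vertex → Vertex
    choose r with r ∈? T
    ... | yes _ = r
    ... | no  _ = twin r

    choose-cases : ∀ r → choose r ≡ r ⊎ choose r ≡ twin r
    choose-cases r with r ∈? T
    ... | yes _ = inj₁ refl
    ... | no  _ = inj₂ refl

    choose-self : ∀ {r} → r ∈ T → choose r ≡ r
    choose-self {r} r∈T with r ∈? T
    ... | yes _   = refl
    ... | no  r∉T = contradiction r∈T r∉T

    choose-∈ : ∀ {r} → r ∈ T ⊎ twin r ∈ T → choose r ∈ T
    choose-∈ {r} hit with r ∈? T
    ... | yes r∈T = r∈T
    ... | no  r∉T = [ (λ r∈T → contradiction r∈T r∉T) , (λ r'∈T → r'∈T) ] hit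

    outer-choose : ∀ {r} → Outer r → Outer (choose r)
    outer-choose {r} outer with choose-cases r
    ... | inj₁ c≡r  = subst Outer (sym c≡r) outer
    ... | inj₂ c≡r' = subst Outer (sym c≡r') (outer-twin {r} outer)

    rep-choose : ∀ r → rep (choose r) ≡ rep r
    rep-choose r with choose-cases r
    ... | inj₁ c≡r  = cong rep c≡r
    ... | inj₂ c≡r' = trans (cong rep c≡r') (rep-twin r)

    twin≢choose : ∀ {r₀ r} → r₀ ∈ representatives → r ∈ representatives → r₀ ∈ T →
                  twin r₀ ≢ choose r
    twin≢choose {r₀} {r} r₀∈reps r∈reps r₀∈T r₀'≡cr = twin-≢ outer-r₀ (begin
      twin r₀   ≡⟨ r₀'≡cr ⟩
      choose r  ≡⟨ cong choose r₀≡r ⟨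
      choose r₀ ≡⟨ choose-self r₀∈T ⟩
      r₀        ∎)
      where
      open ≡-Reasoning
      outer-r₀ : Outer r₀
      outer-r₀ = All.lookup representatives-outer r₀∈reps

      r₀≡r : r₀ ≡ r
      r₀≡r = begin
        r₀             ≡⟨ All.lookup rep-fixes-representatives r₀∈reps ⟨
        rep r₀         ≡⟨ rep-twin r₀ ⟨
        rep (twin r₀)  ≡⟨ cong rep r₀'≡cr ⟩
        rep (choose r) ≡⟨ rep-choose r ⟩
        rep r          ≡⟨ All.lookup rep-fixes-representatives r∈reps ⟩
        r              ∎

  -- The five distinct outer vertices: one vertex of T from each twin pair, plus the
  -- second vertex of a pair contained in T.
  full-pair⇒5≤length-outer :
    Unique T →
    All (λ r → r ∈ T ⊎ twin r ∈ T) representatives →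
    Any (λ r → r ∈ T × twin r ∈ T) representatives →
    5 ≤ length (filter (∁? middle?) T)
  full-pair⇒5≤length-outer unique-T hit full with find full
  ... | r₀ , r₀∈reps , r₀∈T , r₀'∈T =
    unique-⊆⇒length≤ {xs = twin r₀ ∷ chosen} (fresh ∷ unique-chosen) chosen⊆outer
    where
    open ≡-Reasoning

    chosen : List Vertex
    chosen = map choose representatives

    unique-chosen : Unique chosen
    unique-chosen = map⁻ {f = rep} (subst Unique (sym rep-chosen) unique-representatives)
      where
      rep-chosen : map rep chosen ≡ representatives
      rep-chosen = begin
        map rep (map choose representatives) ≡⟨ map-∘ {g = rep} {f = choose} representatives ⟨
        map (rep ∘ choose) representatives   ≡⟨ map-cong rep-choose representatives ⟩
        representatives                       ∎

    fresh : All (twin r₀ ≢_) chosen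
    fresh = All.tabulate λ x∈chosen → case ∈-map⁻ choose x∈chosen of λ where
      (r , r∈reps , refl) → twin≢choose r₀∈reps r∈reps r₀∈T

    chosen⊆outer : (twin r₀ ∷ chosen) ⊆ filter (∁? middle?) T
    chosen⊆outer (here refl) =
      ∈-filter⁺ (∁? middle?) r₀'∈T (outer-twin {r₀} (All.lookup representatives-outer r₀∈reps))
    chosen⊆outer (there x∈chosen) with ∈-map⁻ choose x∈chosen
    ... | r , r∈reps , refl = ∈-filter⁺ (∁? middle?) (choose-∈ (All.lookup hit r∈reps))
                                (outer-choose (All.lookup representatives-outer r∈reps))

missed-pair-fort : ∀ {T : Vertex → Set} {r} → Outer r → ¬ T r → ¬ T (twin r) →
                   AvoidingFort (BF 2) T
missed-pair-fort {r = r} outer r∉T r'∉T = record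
  { F        = λ x → x ≡ r ⊎ x ≡ twin r
  ; isFort   = twin-fort outer
  ; nonempty = r , inj₁ refl
  ; disjoint = λ { v∈T (inj₁ refl) → r∉T v∈T ; v∈T (inj₂ refl) → r'∉T v∈T }
  }

unused-outer-fort : ∀ {T : Vertex → Set} → (∀ {v} → Outer v → ¬ T v ⊎ ¬ T (twin v)) →
                    AvoidingFort (BF 2) T
unused-outer-fort {T} unused = record
  { F        = λ v → Outer v × ¬ T v
  ; isFort   = outer-unused-fort unused
  ; nonempty = [ (λ v₀∉T → v₀ , (λ ()) , v₀∉T) , (λ v₀'∉T → twin v₀ , (λ ()) , v₀'∉T) ]
                 (unused (λ ()))
  ; disjoint = λ v∈T (_ , v∉T) → v∉T v∈T
  }
  where
  v₀ : Vertex
  v₀ = false ∷ false ∷ [] , zero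

module _ {T : List Vertex} where

  private
    hit? : Decidable (λ r → r ∈ T ⊎ twin r ∈ T)
    hit? r = (r ∈? T) ⊎-dec (twin r ∈? T)

    unused? : Decidable (λ r → r ∉ T ⊎ twin r ∉ T)
    unused? r = ¬? (r ∈? T) ⊎-dec ¬? (twin r ∈? T)

  balanced-avoiding-fort : Unique T →
                           length (filter (∁? middle?) T) ≡ length (filter middle? T) →
                           AvoidingFort (BF 2) (_∈ T)
  balanced-avoiding-fort unique-T balanced with all? hit? representatives
  ... | no ¬all-hit with find (¬All⇒Any¬ hit? representatives ¬all-hit)
  ...   | r , r∈reps , missed =
    missed-pair-fort (All.lookup representatives-outer r∈reps) (missed ∘ inj₁) (missed ∘ inj₂)
  balanced-avoiding-fort unique-T balanced | yes all-hit with all? unused? representatives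
  ...   | yes all-unused = unused-outer-fort λ outer →
    pair-from-rep (_∉ T) outer (All.lookup all-unused (rep∈representatives outer))
  ...   | no ¬all-unused = contradiction (begin-strict
    4                              <⟨ full-pair⇒5≤length-outer unique-T all-hit full ⟩
    length (filter (∁? middle?) T) ≡⟨ balanced ⟩
    length (filter middle? T)      ≤⟨ length-middle≤4 unique-T ⟩
    4                              ∎) (n≮n 4)
    where
    open ≤-Reasoning
    full : Any (λ r → r ∈ T × twin r ∈ T) representatives
    full = Any.map (λ ¬unused → decidable-stable (_ ∈? T) (¬unused ∘ inj₁)
                              , decidable-stable (_ ∈? T) (¬unused ∘ inj₂))
                   (¬All⇒Any¬ unused? representatives ¬all-unused)

matching-avoiding-fort : ∀ {K} → IsMatching (BF 2) K → AvoidingFort (BF 2) (_∈ endpoints K)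
matching-avoiding-fort (edges , unique-endpoints) = balanced-avoiding-fort unique-endpoints
  (sym (straddling-endpoints-balanced middle? (All.map adj-straddles edges)))

theorem4p1 : ¬ HasEdgeForcingSet (BF 2)
theorem4p1 (K , matching , forces) =
  avoidingFort⇒¬forcing (matching-avoiding-fort matching) forces
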